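{- Let $d$ be a positive integer, let $S,T\subseteq\mathbb{N}^d$ be generalized numerical semigroups, $f:S\rightarrow T$ a monoid isomorphism and $\mathbf{x}\in\operatorname{SG}(S)$. Let $\mathbf{n}\in S\setminus\{\mathbf{0}\}$ and let $\mathbf{s}$ be a maximal element of $\operatorname{Ap}(S,\mathbf{n})$ with respect to $\leq_S$ such that $\mathbf{x}=\mathbf{s}-\mathbf{n}$, and set $\mathbf{y}=f(\mathbf{s})-f(\mathbf{n})$. Then $\mathbf{y}\in\operatorname{SG}(T)$ and $f(2\mathbf{x})=2\mathbf{y}$.
   Context: A generalized numerical semigroup (GNS) in $\mathbb{N}^d$ is a submonoid $S$ of $(\mathbb{N}^d,+)$ with $\operatorname{H}(S)=\mathbb{N}^d\setminus S$ finite. For $L\subseteq\mathbb{N}^d$, $\mathbf{a}\leq_L\mathbf{b}$ means $\mathbf{b}-\mathbf{a}\in L$. $\operatorname{Ap}(S,\mathbf{n})=\{\mathbf{z}\in S\mid\mathbf{z}-\mathbf{n}\notin S\}$. $\operatorname{PF}(S)=\{\mathbf{h}\in\operatorname{H}(S)\mid\mathbf{h}+\mathbf{s}\in S\ \forall\mathbf{s}\in S\setminus\{\mathbf{0}\}\}$ and $\operatorname{SG}(S)=\{\mathbf{h}\in\operatorname{PF}(S)\mid 2\mathbf{h}\in S\}$. -}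

module Defs where

open import Data.Nat using (ℕ; _≤_)
open import Data.Vec using (Vec; replicate; zipWith)
open import Data.List using (List)
open import Data.List.Membership.Propositional using (_∈_)
open import Data.Product using (Σ; ∃; _×_)
open import Relation.Nullary using (¬_)
open import Relation.Binary.PropositionalEquality using (_≡_)

Pt : ℕ → Set
Pt d = Vec ℕ d

Subset : ℕ → Set₁
Subset d = Pt d → Set

𝟎 : ∀ {d} → Pt d
𝟎 = replicate _ 0

infixl 6 _⊕_
_⊕_ : ∀ {d} → Pt d → Pt d → Pt d
_⊕_ = zipWith Data.Nat._+_

H : ∀ {d} → Subset d → Subset d
H S v = ¬ S v

record IsGNS {d : ℕ} (S : Subset d) : Set where
  field
    zero∈ : S 𝟎
    closed : ∀ a b → S a → S b → S (a ⊕ b)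
    finiteHoles : Σ (List (Pt d)) λ L → ∀ v → H S v → v ∈ L

_≤[_]_ : ∀ {d} → Pt d → Subset d → Pt d → Set
a ≤[ L ] b = ∃ λ c → L c × b ≡ a ⊕ c

-- Apéry set Ap(S,n) = { z ∈ S | z - n ∉ S }   (z - n ∈ S means z = w + n with w ∈ S)
Ap : ∀ {d} → Subset d → Pt d → Subset d
Ap S n z = S z × ¬ (∃ λ w → S w × z ≡ w ⊕ n)

IsMaximalIn : ∀ {d} → Subset d → Subset d → Pt d → Set
IsMaximalIn S A s = A s × (∀ t → A t → s ≤[ S ] t → t ≡ s)

PF : ∀ {d} → Subset d → Subset d
PF S h = H S h × (∀ s → S s → ¬ s ≡ 𝟎 → S (h ⊕ s))

SG : ∀ {d} → Subset d → Subset d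
SG S h = PF S h × S (h ⊕ h)

-- A monoid isomorphism f : S → T, given as a map on ℕ^d whose values outside S are irrelevant.
record IsMonoidIso {d : ℕ} (S T : Subset d) (f : Pt d → Pt d) : Set where
  field
    maps : ∀ a → S a → T (f a)
    pres-𝟎 : f 𝟎 ≡ 𝟎
    pres-⊕ : ∀ a b → S a → S b → f (a ⊕ b) ≡ f a ⊕ f b
    injective : ∀ a b → S a → S b → f a ≡ f b → a ≡ b
    surjective : ∀ c → T c → ∃ λ a → S a × f a ≡ c

{-# OPTIONS --safe #-}
module Submission where

-- Since s = x + n lies in S, applying f to 2s = 2x + 2n gives 2 f(s) = f(2x) + 2 f(n).
-- In ℕ^d this forces f(s) - f(n) =: y to exist, with 2y = f(2x). Everything else follows
-- from the fact that doubling is injective on ℕ^d: if y = f(a) were in T then f(2a) = f(2x),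
-- so a = x ∈ S; and for t = f(b) ≠ 0 in T, doubling f(x + b) and y + t gives the same point
-- f(2x) + 2t, so y + t = f(x + b) ∈ T.

open import Defs
open import Algebra.Bundles using (CommutativeSemigroup)
open import Data.Nat using (ℕ; _≤_; zero; suc; _+_)
open import Data.Nat.Properties using (+-suc; +-assoc; +-comm; +-identityʳ; suc-injective)
open import Data.Vec using ([]; _∷_)
open import Data.Vec.Properties using (zipWith-assoc; zipWith-comm; ∷-injective)
open import Data.Product using (∃; _×_; _,_)
open import Level using (0ℓ)
open import Relation.Nullary using (¬_)
open import Relation.Binary.PropositionalEquality
open import Relation.Binary.PropositionalEquality.Algebra using (isMagma)

+-double-injective : ∀ m n → m + m ≡ n + n → m ≡ n
+-double-injective zero    zero    _ = refl
+-double-injective (suc m) (suc n) e =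
  cong suc (+-double-injective m n (suc-injective (begin
    suc (m + m)   ≡⟨ sym (+-suc m m) ⟩
    m + suc m     ≡⟨ suc-injective e ⟩
    n + suc n     ≡⟨ +-suc n n ⟩
    suc (n + n)   ∎)))
  where open ≡-Reasoning

+-halve : ∀ c a b → c + c ≡ a + (b + b) → ∃ λ y → c ≡ y + b × a ≡ y + y
+-halve c a zero e =
  c , sym (+-identityʳ c) , trans (sym (+-identityʳ a)) (sym e)
+-halve zero a (suc b) e with () ← trans e (+-suc a (b + suc b))
+-halve (suc c) a (suc b) e with +-halve c a b (suc-injective (suc-injective (begin
    suc (suc (c + c))       ≡⟨ cong suc (sym (+-suc c c)) ⟩
    suc c + suc c           ≡⟨ e ⟩
    a + suc (b + suc b)     ≡⟨ +-suc a (b + suc b) ⟩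
    suc (a + (b + suc b))   ≡⟨ cong (λ k → suc (a + k)) (+-suc b b) ⟩
    suc (a + suc (b + b))   ≡⟨ cong suc (+-suc a (b + b)) ⟩
    suc (suc (a + (b + b))) ∎)))
  where open ≡-Reasoning
... | y , c≡y+b , a≡y+y = y , trans (cong suc c≡y+b) (sym (+-suc y b)) , a≡y+y

⊕-commutativeSemigroup : ℕ → CommutativeSemigroup 0ℓ 0ℓ
⊕-commutativeSemigroup d = record
  { Carrier                = Pt d
  ; _≈_                    = _≡_
  ; _∙_                    = _⊕_
  ; isCommutativeSemigroup = record
    { isSemigroup = record { isMagma = isMagma _⊕_ ; assoc = zipWith-assoc +-assoc }
    ; comm        = zipWith-comm +-comm
    }
  }

⊕-interchange : ∀ {d} (a b c e : Pt d) → (a ⊕ b) ⊕ (c ⊕ e) ≡ (a ⊕ c) ⊕ (b ⊕ e)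
⊕-interchange {d} = interchange
  where open import Algebra.Properties.CommutativeSemigroup (⊕-commutativeSemigroup d)

⊕-double-injective : ∀ {d} (u v : Pt d) → u ⊕ u ≡ v ⊕ v → u ≡ v
⊕-double-injective []       []       _ = refl
⊕-double-injective (m ∷ us) (n ∷ vs) e with e₀ , e₁ ← ∷-injective e =
  cong₂ _∷_ (+-double-injective m n e₀) (⊕-double-injective us vs e₁)

⊕-halve : ∀ {d} (c a b : Pt d) → c ⊕ c ≡ a ⊕ (b ⊕ b) → ∃ λ y → c ≡ y ⊕ b × a ≡ y ⊕ y
⊕-halve []       []       []       _ = [] , refl , refl
⊕-halve (c ∷ cs) (a ∷ as) (b ∷ bs) e
  with e₀ , e₁ ← ∷-injective e
  with y , c≡y+b , a≡y+y ← +-halve c a b e₀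
  with ys , cs≡ys+bs , as≡ys+ys ← ⊕-halve cs as bs e₁
  = y ∷ ys , cong₂ _∷_ c≡y+b cs≡ys+bs , cong₂ _∷_ a≡y+y as≡ys+ys

module _ {d} {S T : Subset d} {f : Pt d → Pt d} (iso : IsMonoidIso S T f)
         (closed : ∀ a b → S a → S b → S (a ⊕ b)) where

  open IsMonoidIso iso

  double-image-of-⊕ : ∀ {a b} → S (a ⊕ b) → S (a ⊕ a) → S b →
                      f (a ⊕ b) ⊕ f (a ⊕ b) ≡ f (a ⊕ a) ⊕ (f b ⊕ f b)
  double-image-of-⊕ {a} {b} a+b∈S a+a∈S b∈S = begin
    f (a ⊕ b) ⊕ f (a ⊕ b)     ≡⟨ sym (pres-⊕ _ _ a+b∈S a+b∈S) ⟩
    f ((a ⊕ b) ⊕ (a ⊕ b))     ≡⟨ cong f (⊕-interchange a b a b) ⟩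
    f ((a ⊕ a) ⊕ (b ⊕ b))     ≡⟨ pres-⊕ _ _ a+a∈S (closed b b b∈S b∈S) ⟩
    f (a ⊕ a) ⊕ f (b ⊕ b)     ≡⟨ cong (f (a ⊕ a) ⊕_) (pres-⊕ b b b∈S b∈S) ⟩
    f (a ⊕ a) ⊕ (f b ⊕ f b)   ∎
    where open ≡-Reasoning

  half-of-image-∈SG : ∀ {x y} → SG S x → f (x ⊕ x) ≡ y ⊕ y → SG T y
  half-of-image-∈SG {x} {y} ((x∉S , x∈PF) , x+x∈S) f[x+x]≡y+y =
    (y∉T , y∈PF) , subst T f[x+x]≡y+y (maps _ x+x∈S)
    where
    y∉T : ¬ T y
    y∉T y∈T with a , a∈S , fa≡y ← surjective y y∈T =
      x∉S (subst S (⊕-double-injective a x a+a≡x+x) a∈S)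
      where
      a+a≡x+x : a ⊕ a ≡ x ⊕ x
      a+a≡x+x = injective _ _ (closed a a a∈S a∈S) x+x∈S (begin
        f (a ⊕ a)   ≡⟨ pres-⊕ a a a∈S a∈S ⟩
        f a ⊕ f a   ≡⟨ cong (λ z → z ⊕ z) fa≡y ⟩
        y ⊕ y       ≡⟨ sym f[x+x]≡y+y ⟩
        f (x ⊕ x)   ∎)
        where open ≡-Reasoning

    y∈PF : ∀ t → T t → ¬ t ≡ 𝟎 → T (y ⊕ t)
    y∈PF t t∈T t≢𝟎 with b , b∈S , fb≡t ← surjective t t∈T =
      subst T (⊕-double-injective _ _ doubles-agree) (maps _ x+b∈S)
      where
      x+b∈S : S (x ⊕ b)
      x+b∈S = x∈PF b b∈S (λ b≡𝟎 → t≢𝟎 (trans (sym fb≡t) (trans (cong f b≡𝟎) pres-𝟎)))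

      doubles-agree : f (x ⊕ b) ⊕ f (x ⊕ b) ≡ (y ⊕ t) ⊕ (y ⊕ t)
      doubles-agree = begin
        f (x ⊕ b) ⊕ f (x ⊕ b)   ≡⟨ double-image-of-⊕ x+b∈S x+x∈S b∈S ⟩
        f (x ⊕ x) ⊕ (f b ⊕ f b) ≡⟨ cong₂ (λ u v → u ⊕ (v ⊕ v)) f[x+x]≡y+y fb≡t ⟩
        (y ⊕ y) ⊕ (t ⊕ t)       ≡⟨ ⊕-interchange y y t t ⟩
        (y ⊕ t) ⊕ (y ⊕ t)       ∎
        where open ≡-Reasoning

mainTheorem16 : (d : ℕ) → 1 ≤ d → (S T : Subset d) → IsGNS S → IsGNS T
    → (f : Pt d → Pt d) → IsMonoidIso S T f
    → (x : Pt d) → SG S x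
    → (n : Pt d) → S n → ¬ n ≡ 𝟎
    → (s : Pt d) → IsMaximalIn S (Ap S n) s → s ≡ x ⊕ n
    → ∃ λ y → f s ≡ y ⊕ f n × SG T y × f (x ⊕ x) ≡ y ⊕ y
mainTheorem16 _ _ S T S-GNS _ f iso x x∈SG@(_ , x+x∈S) n n∈S _ _ ((s∈S , _) , _) refl
  with y , fs≡y+fn , f[x+x]≡y+y ← ⊕-halve (f (x ⊕ n)) (f (x ⊕ x)) (f n)
         (double-image-of-⊕ iso (IsGNS.closed S-GNS) s∈S x+x∈S n∈S)
  = y , fs≡y+fn , half-of-image-∈SG iso (IsGNS.closed S-GNS) x∈SG f[x+x]≡y+y , f[x+x]≡y+y
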